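{- Let $M \ge 2$ and let $g_1, \dots, g_M:\mathbb{N}\to\mathbb{Z}$ be additive functions defined by the nonconstant polynomials $G_1, \dots, G_M \in \mathbb{Z}[T]$, respectively; let $D = \max_i \deg G_i$ and let $\ell$ be a prime. If $\alpha_{k_1G_1 + \cdots + k_MG_M}(\ell) \ne 0$ for all integer tuples $(k_1, \dots, k_M)$ with $\gcd(k_1, \dots, k_M) = 1$, then the reductions of $G_1, \dots, G_M$ modulo $\ell$ are linearly independent over $\mathbb{F}_\ell$. If moreover $\ell > D+1$, this condition is also sufficient: $\mathbb{F}_\ell$-linear independence of the reductions of $G_1,\dots,G_M$ implies $\alpha_{k_1G_1 + \cdots + k_MG_M}(\ell) \ne 0$ for all integer tuples with $\gcd(k_1,\dots,k_M)=1$.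
   Context: For $H\in\mathbb{Z}[T]$ and a positive integer $q$, $\alpha_H(q)=\frac{1}{\phi(q)}\#\{v\in U_q: H(v)\in U_q\}$, where $U_q$ is the group of units mod $q$. An additive function is $g:\mathbb{N}\to\mathbb{Z}$ with $g(mn)=g(m)+g(n)$ for coprime $m,n$; it is defined by $G$ if $g(p)=G(p)$ for all primes $p$. The condition $\gcd(k_1,\dots,k_M)=1$ implicitly requires $(k_1,\dots,k_M)\neq(0,\dots,0)$. -}

module Defs where

open import Data.Nat as ℕ using (ℕ; zero; suc)
open import Data.Nat.GCD using (gcd)
open import Data.Nat.Coprimality using (Coprime)
open import Data.Integer as ℤ using (ℤ; +_)
open import Data.Integer.Divisibility using () renaming (_∣_ to _∣ℤ_)
open import Data.Rational as ℚ using (ℚ; 0ℚ)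
open import Data.Fin using (Fin; zero; suc)
open import Data.List using (List; []; _∷_; upTo; filter; length)
open import Data.Bool using (Bool; true; false; if_then_else_; _∧_)
open import Relation.Binary.PropositionalEquality using (_≡_)
open import Relation.Nullary using (¬_)
open import Relation.Nullary.Decidable using (isYes)
open import Data.Integer.Properties using () renaming (_≟_ to _≟ℤ_)

-- Polynomials in ℤ[T] as coefficient lists, lowest degree first
-- (trailing zero coefficients are allowed; all notions below are
-- invariant under them).

Poly : Set
Poly = List ℤ

coeff : Poly → ℕ → ℤ
coeff []       _       = + 0
coeff (a ∷ p)  zero    = a
coeff (a ∷ p)  (suc j) = coeff p j

isZeroPoly : Poly → Bool
isZeroPoly []      = true
isZeroPoly (a ∷ p) = (isYes (a ≟ℤ + 0)) ∧ isZeroPoly p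

-- degree (the zero polynomial gets degree 0)
deg : Poly → ℕ
deg []      = 0
deg (a ∷ p) = if isZeroPoly p then 0 else suc (deg p)

eval : Poly → ℤ → ℤ
eval []      v = + 0
eval (a ∷ p) v = a ℤ.+ v ℤ.* eval p v

_+P_ : Poly → Poly → Poly
[]      +P q       = q
(a ∷ p) +P []      = a ∷ p
(a ∷ p) +P (b ∷ q) = (a ℤ.+ b) ∷ (p +P q)

_·P_ : ℤ → Poly → Poly
k ·P []      = []
k ·P (a ∷ p) = (k ℤ.* a) ∷ (k ·P p)

linComb : ∀ {M} → (Fin M → ℤ) → (Fin M → Poly) → Poly
linComb {zero}  k G = []
linComb {suc M} k G = (k zero ·P G zero) +P linComb (λ i → k (suc i)) (λ i → G (suc i))

maxDeg : ∀ {M} → (Fin M → Poly) → ℕ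
maxDeg {zero}  G = 0
maxDeg {suc M} G = deg (G zero) ℕ.⊔ maxDeg (λ i → G (suc i))

-- gcd(k_1,…,k_M) (of absolute values; gcd of the zero tuple is 0)
gcdTuple : ∀ {M} → (Fin M → ℤ) → ℕ
gcdTuple {zero}  k = 0
gcdTuple {suc M} k = gcd ℤ.∣ k zero ∣ (gcdTuple (λ i → k (suc i)))

-- α_H(q) = #{v ∈ U_q : H(v) ∈ U_q} / φ(q)

isUnitMod : ℕ → ℕ → Bool
isUnitMod q n = gcd n q ℕ.≡ᵇ 1

-- U_q, represented by residues 0 ≤ v < q coprime to q
unitsMod : ℕ → List ℕ
unitsMod q = filterB (isUnitMod q) (upTo q)
  where
  filterB : (ℕ → Bool) → List ℕ → List ℕ
  filterB f []       = []
  filterB f (x ∷ xs) = if f x then x ∷ filterB f xs else filterB f xs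

φ : ℕ → ℕ
φ q = length (unitsMod q)

countGood : Poly → ℕ → List ℕ → ℕ
countGood H q []       = 0
countGood H q (v ∷ vs) =
  if isUnitMod q ℤ.∣ eval H (+ v) ∣ then suc (countGood H q vs) else countGood H q vs

ratio : ℕ → ℕ → ℚ
ratio n zero    = 0ℚ
ratio n (suc d) = (+ n) ℚ./ suc d

α : Poly → ℕ → ℚ
α H q = ratio (countGood H q (unitsMod q)) (φ q)

Additive : (ℕ → ℤ) → Set
Additive g = ∀ m n → 1 ℕ.≤ m → 1 ℕ.≤ n → Coprime m n → g (m ℕ.* n) ≡ g m ℤ.+ g n

AlphaCondition : ∀ {M} → (Fin M → Poly) → ℕ → Set
AlphaCondition G ℓ = ∀ k → gcdTuple k ≡ 1 → ¬ (α (linComb k G) ℓ ≡ 0ℚ)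

-- The reductions of G_1,…,G_M mod ℓ are linearly independent over 𝔽_ℓ:
-- for coefficients c_i (integer lifts of elements of 𝔽_ℓ), if Σ c_i G_i
-- vanishes mod ℓ coefficientwise, then every c_i ≡ 0 mod ℓ.
LinIndepModℓ : ∀ {M} → (Fin M → Poly) → ℕ → Set
LinIndepModℓ {M} G ℓ =
  ∀ (c : Fin M → ℤ) → (∀ j → (+ ℓ) ∣ℤ coeff (linComb c G) j) → ∀ i → (+ ℓ) ∣ℤ c i

{-# OPTIONS --safe #-}
-- α_H(ℓ) = 0 says exactly that ℓ ∣ H(v) for every unit v mod ℓ. So α_H(ℓ) = 0 when ℓ divides
-- every coefficient of H; conversely, if D + 1 < ℓ and deg H ≤ D, then α_H(ℓ) = 0 makes the
-- units 1, …, D + 1 roots of H in 𝔽_ℓ, which forces H ≡ 0 (mod ℓ).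
-- Necessity: a relation Σ cᵢGᵢ ≡ 0 (mod ℓ) with ℓ ∤ cᵢ lifts to a tuple k ≡ c (mod ℓ) with
-- gcd 1, by replacing another entry x = c_j with x + ℓe(1 − x) where ℓe ≡ 1 (mod cᵢ); then
-- α_{Σ kᵢGᵢ}(ℓ) = 0. Sufficiency: if gcd k = 1 but α_{Σ kᵢGᵢ}(ℓ) = 0, then Σ kᵢGᵢ ≡ 0 (mod ℓ),
-- so by independence ℓ divides every kᵢ and hence gcd k = 1.
module Submission where

open import Defs

-- Integer arithmetic is opened only inside this module, so that + in lemma2p4 is ℕ's.
module _ where
  open import Data.Bool using (Bool; true; false)
  open import Data.Bool.Properties using (T-≡; ¬-not)
  open import Data.Fin using (Fin; zero; suc; _≟_)
  open import Data.Fin.Properties using (punchInᵢ≢i)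
  open import Data.Integer as ℤ using (ℤ; +_; 0ℤ; 1ℤ; _+_; _-_; -_; _*_; ∣_∣)
  open import Data.Integer.Properties
    using (+-identityˡ; +-identityʳ; *-zeroʳ; *-comm; +-inverseʳ; neg-distribˡ-*; pos-+; pos-*;
           m-n≡m⊖n; ∣⊖∣-<)
  open import Data.Integer.Divisibility.Signed
    using (_∣_; divides; ∣ᵤ⇒∣; ∣⇒∣ᵤ; ∣-refl; ∣-trans; m∣∣m∣; ∣m∣n⇒∣m+n; ∣m∣n⇒∣m-n; ∣m+n∣m⇒∣n; ∣m+n∣n⇒∣m;
           ∣n⇒∣m*n; ∣m⇒∣m*n)
  open import Data.Integer.Coprimality using (coprime-divisor)
  open import Data.Integer.Tactic.RingSolver using (solve-∀)
  open import Data.List using (List; []; _∷_; upTo; length)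
  open import Data.List.Membership.Propositional using (_∈_)
  open import Data.List.Membership.Propositional.Properties using (∈-upTo⁺)
  open import Data.List.Relation.Unary.Any using (here; there)
  open import Data.Nat as ℕ using (ℕ; zero; suc; _≤_; _<_; _∸_; z≤n; s≤s; >-nonZero)
  open import Data.Nat.Properties
    using (+-comm; ≤-pred; ≤-refl; n<1+n; m≤n⇒m≤1+n; <-trans; ≤-<-trans; m∸n≤m; m<n⇒0<n∸m; m⊔n<o⇒m<o;
           m⊔n<o⇒n<o; ≡ᵇ⇒≡; ≡⇒≡ᵇ)
  open import Data.Nat.Divisibility
    using (_∣?_; ∣1⇒≡1; _∣0) renaming (_∣_ to _∣ℕ_; ∣-refl to ∣ℕ-refl; ∣-trans to ∣ℕ-trans)
  open import Data.Nat.GCD using (gcd; gcd[m,n]∣m; gcd[m,n]∣n; gcd-greatest; module Bézout)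
  open import Data.Nat.Coprimality
    using (Coprime; coprime⇒gcd≡1; gcd≡1⇒coprime; coprime-Bézout; prime⇒coprime)
    renaming (sym to coprime-sym)
  open import Data.Nat.Primality using (Prime; prime⇒irreducible; ¬prime[1])
  open import Data.Product using (∃; _×_; _,_)
  open import Data.Rational using (0ℚ)
  open import Data.Rational.Properties using (0/n≡0; normalize-pos; positive⁻¹; <-irrefl)
  open import Data.Sum using (inj₁; inj₂)
  open import Data.Vec.Functional using (updateAt)
  open import Data.Vec.Functional.Properties using (updateAt-updates; updateAt-minimal)
  open import Function using (_∘_; _⇔_; mk⇔; Equivalence)
  open import Relation.Nullary using (¬_; yes; no; contradiction)
  open import Relation.Binary.PropositionalEquality
  open ≡-Reasoning

  ∣0ℤ : ∀ {m} → m ∣ 0ℤ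
  ∣0ℤ = divides 0ℤ refl

  infix 4 _∣ₚ_ _∣ₚ_from_

  _∣ₚ_ : ℤ → Poly → Set
  m ∣ₚ P = ∀ j → m ∣ coeff P j

  _∣ₚ_from_ : ℤ → Poly → ℕ → Set
  m ∣ₚ P from n = ∀ j → n ≤ j → m ∣ coeff P j

  coeff-+P : ∀ p q j → coeff (p +P q) j ≡ coeff p j + coeff q j
  coeff-+P []      q       j       = sym (+-identityˡ _)
  coeff-+P (a ∷ p) []      j       = sym (+-identityʳ _)
  coeff-+P (a ∷ p) (b ∷ q) zero    = refl
  coeff-+P (a ∷ p) (b ∷ q) (suc j) = coeff-+P p q j

  coeff-·P : ∀ k p j → coeff (k ·P p) j ≡ k * coeff p j
  coeff-·P k []      j       = sym (*-zeroʳ k)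
  coeff-·P k (a ∷ p) zero    = refl
  coeff-·P k (a ∷ p) (suc j) = coeff-·P k p j

  coeff-linComb-suc : ∀ {M} (k : Fin (suc M) → ℤ) G j →
    coeff (linComb k G) j ≡ k zero * coeff (G zero) j + coeff (linComb (k ∘ suc) (G ∘ suc)) j
  coeff-linComb-suc k G j =
    trans (coeff-+P (k zero ·P G zero) _ j) (cong₂ _+_ (coeff-·P (k zero) (G zero) j) refl)

  isZeroPoly⇒coeff≡0 : ∀ p → isZeroPoly p ≡ true → ∀ j → coeff p j ≡ 0ℤ
  isZeroPoly⇒coeff≡0 []      _ j = refl
  isZeroPoly⇒coeff≡0 (a ∷ p) z j with a ℤ.≟ 0ℤ
  isZeroPoly⇒coeff≡0 (a ∷ p) z zero    | yes a≡0 = a≡0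
  isZeroPoly⇒coeff≡0 (a ∷ p) z (suc j) | yes _   = isZeroPoly⇒coeff≡0 p z j

  deg<⇒coeff≡0 : ∀ p {j} → deg p < j → coeff p j ≡ 0ℤ
  deg<⇒coeff≡0 []      _ = refl
  deg<⇒coeff≡0 (a ∷ p) {suc j} d<j with isZeroPoly p in z
  ... | true  = isZeroPoly⇒coeff≡0 p z j
  ... | false = deg<⇒coeff≡0 p (≤-pred d<j)

  coeff-linComb-maxDeg< : ∀ {M} (k : Fin M → ℤ) G {j} → maxDeg G < j → coeff (linComb k G) j ≡ 0ℤ
  coeff-linComb-maxDeg< {zero}  k G D<j = refl
  coeff-linComb-maxDeg< {suc M} k G {j} D<j = begin
    coeff (linComb k G) j
      ≡⟨ coeff-linComb-suc k G j ⟩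
    k zero * coeff (G zero) j + coeff (linComb (k ∘ suc) (G ∘ suc)) j
      ≡⟨ cong₂ (λ a b → k zero * a + b) G₀-vanishes rest-vanishes ⟩
    k zero * 0ℤ + 0ℤ
      ≡⟨ +-identityʳ _ ⟩
    k zero * 0ℤ
      ≡⟨ *-zeroʳ (k zero) ⟩
    0ℤ
      ∎
    where
    G₀-vanishes : coeff (G zero) j ≡ 0ℤ
    G₀-vanishes = deg<⇒coeff≡0 (G zero) (m⊔n<o⇒m<o _ _ D<j)
    rest-vanishes : coeff (linComb (k ∘ suc) (G ∘ suc)) j ≡ 0ℤ
    rest-vanishes = coeff-linComb-maxDeg< (k ∘ suc) (G ∘ suc) (m⊔n<o⇒n<o (deg (G zero)) _ D<j)

  coeff-linComb-cong : ∀ {M m} (k c : Fin M → ℤ) G → (∀ i → m ∣ k i - c i) →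
    ∀ j → m ∣ coeff (linComb k G) j - coeff (linComb c G) j
  coeff-linComb-cong {zero}      k c G k≡c j = ∣0ℤ
  coeff-linComb-cong {suc M} {m} k c G k≡c j
    rewrite coeff-linComb-suc k G j | coeff-linComb-suc c G j =
    subst (m ∣_) (sym (regroup (k zero) (c zero) (coeff (G zero) j) _ _))
      (∣m∣n⇒∣m+n (∣m⇒∣m*n _ (k≡c zero)) (coeff-linComb-cong (k ∘ suc) (c ∘ suc) (G ∘ suc) (k≡c ∘ suc) j))
    where
    regroup : ∀ a b g s t → (a * g + s) - (b * g + t) ≡ (a - b) * g + (s - t)
    regroup = solve-∀

  ∣ₚ-linComb-cong : ∀ {M m} (k c : Fin M → ℤ) G → (∀ i → m ∣ k i - c i) →
    m ∣ₚ linComb c G → m ∣ₚ linComb k G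
  ∣ₚ-linComb-cong {m = m} k c G k≡c m∣c j =
    subst (m ∣_) (sub-add _ _) (∣m∣n⇒∣m+n (coeff-linComb-cong k c G k≡c j) (m∣c j))
    where
    sub-add : ∀ x y → x - y + y ≡ x
    sub-add = solve-∀

  ∣ₚ⇒∣eval : ∀ {m} P → m ∣ₚ P → ∀ v → m ∣ eval P v
  ∣ₚ⇒∣eval []      m∣P v = ∣0ℤ
  ∣ₚ⇒∣eval (a ∷ P) m∣P v = ∣m∣n⇒∣m+n (m∣P zero) (∣n⇒∣m*n v (∣ₚ⇒∣eval P (m∣P ∘ suc) v))

  _/[X-_] : Poly → ℤ → Poly
  []      /[X- a ] = []
  (p ∷ P) /[X- a ] = eval P a ∷ (P /[X- a ])

  remainder-theorem : ∀ P x a → eval P x ≡ eval P a + (x - a) * eval (P /[X- a ]) x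
  remainder-theorem []      x a = sym (trans (+-identityˡ _) (*-zeroʳ (x - a)))
  remainder-theorem (p ∷ P) x a = begin
    p + x * eval P x
      ≡⟨ cong (λ e → p + x * e) (remainder-theorem P x a) ⟩
    p + x * (eval P a + (x - a) * eval (P /[X- a ]) x)
      ≡⟨ expand p x a (eval P a) (eval (P /[X- a ]) x) ⟩
    (p + a * eval P a) + (x - a) * (eval P a + x * eval (P /[X- a ]) x)
      ∎
    where
    expand : ∀ p x a e q → p + x * (e + (x - a) * q) ≡ (p + a * e) + (x - a) * (e + x * q)
    expand = solve-∀

  /[X-]-∣ₚ-from : ∀ {m} n P a → m ∣ₚ P from suc n → m ∣ₚ P /[X- a ] from n
  /[X-]-∣ₚ-from n       []      a m∣P j       _         = ∣0ℤ
  /[X-]-∣ₚ-from zero    (p ∷ P) a m∣P zero    _         = ∣ₚ⇒∣eval P (λ j → m∣P (suc j) (s≤s z≤n)) a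
  /[X-]-∣ₚ-from zero    (p ∷ P) a m∣P (suc j) _         =
    /[X-]-∣ₚ-from zero P a (λ j _ → m∣P (suc j) (s≤s z≤n)) j z≤n
  /[X-]-∣ₚ-from (suc n) (p ∷ P) a m∣P (suc j) (s≤s n≤j) =
    /[X-]-∣ₚ-from n P a (λ j → m∣P (suc j) ∘ s≤s) j n≤j

  ∣ₚ/[X-]⇒∣ₚ : ∀ {m} P a → m ∣ eval P a → m ∣ₚ P /[X- a ] → m ∣ₚ P
  ∣ₚ/[X-]⇒∣ₚ []      a m∣Pa m∣Q j       = ∣0ℤ
  ∣ₚ/[X-]⇒∣ₚ (p ∷ P) a m∣Pa m∣Q zero    = ∣m+n∣n⇒∣m m∣Pa (∣n⇒∣m*n a (m∣Q zero))
  ∣ₚ/[X-]⇒∣ₚ (p ∷ P) a m∣Pa m∣Q (suc j) = ∣ₚ/[X-]⇒∣ₚ P a (m∣Q zero) (m∣Q ∘ suc) j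

  gcdTuple∣ : ∀ {M} (k : Fin M → ℤ) i → gcdTuple k ∣ℕ ∣ k i ∣
  gcdTuple∣ {suc M} k zero    = gcd[m,n]∣m ∣ k zero ∣ (gcdTuple (k ∘ suc))
  gcdTuple∣ {suc M} k (suc i) =
    ∣ℕ-trans (gcd[m,n]∣n ∣ k zero ∣ (gcdTuple (k ∘ suc))) (gcdTuple∣ (k ∘ suc) i)

  ∣gcdTuple : ∀ {M d} (k : Fin M → ℤ) → (∀ i → d ∣ℕ ∣ k i ∣) → d ∣ℕ gcdTuple k
  ∣gcdTuple {zero}  k d∣k = _ ∣0
  ∣gcdTuple {suc M} k d∣k = gcd-greatest (d∣k zero) (∣gcdTuple (k ∘ suc) (d∣k ∘ suc))

  gcdTuple-updateAt≡1 : ∀ {M} (c : Fin M → ℤ) {i j} → j ≢ i → ∀ y → c i ∣ y - 1ℤ →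
    gcdTuple (updateAt c j (λ _ → y)) ≡ 1
  gcdTuple-updateAt≡1 c {i} {j} j≢i y cᵢ∣y-1 = ∣1⇒≡1 (∣⇒∣ᵤ g∣1)
    where
    g : ℕ
    g = gcdTuple (updateAt c j (λ _ → y))
    g∣cᵢ : + g ∣ c i
    g∣cᵢ = ∣ᵤ⇒∣ (subst (λ kᵢ → g ∣ℕ ∣ kᵢ ∣) (updateAt-minimal i j c (j≢i ∘ sym)) (gcdTuple∣ _ i))
    g∣y : + g ∣ y
    g∣y = ∣ᵤ⇒∣ (subst (λ kⱼ → g ∣ℕ ∣ kⱼ ∣) (updateAt-updates j c) (gcdTuple∣ _ j))
    difference : ∀ y → y - (y - 1ℤ) ≡ 1ℤ
    difference = solve-∀
    g∣1 : + g ∣ 1ℤ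
    g∣1 = subst (+ g ∣_) (difference y) (∣m∣n⇒∣m-n g∣y (∣-trans g∣cᵢ cᵢ∣y-1))

  updateAt-cong-mod : ∀ {M m} (c : Fin M → ℤ) j {y} → + m ∣ y - c j →
    ∀ t → + m ∣ updateAt c j (λ _ → y) t - c t
  updateAt-cong-mod {m = m} c j m∣y-cⱼ t with t ≟ j
  ... | yes refl = subst (λ kₜ → + m ∣ kₜ - c t) (sym (updateAt-updates t c)) m∣y-cⱼ
  ... | no t≢j   = subst (λ kₜ → + m ∣ kₜ - c t) (sym (updateAt-minimal t j c t≢j))
                     (subst (+ m ∣_) (sym (+-inverseʳ (c t))) ∣0ℤ)

  pos-1+ab≡cd : ∀ {a b c d} → 1 ℕ.+ a ℕ.* b ≡ c ℕ.* d → 1ℤ + + a * + b ≡ + c * + d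
  pos-1+ab≡cd {a} {b} {c} {d} eq = begin
    1ℤ + + a * + b     ≡⟨ cong (λ t → 1ℤ + t) (pos-* a b) ⟨
    1ℤ + + (a ℕ.* b)   ≡⟨ pos-+ 1 (a ℕ.* b) ⟨
    + (1 ℕ.+ a ℕ.* b)  ≡⟨ cong +_ eq ⟩
    + (c ℕ.* d)        ≡⟨ pos-* c d ⟩
    + c * + d          ∎

  coprime⇒inverse : ∀ {m n} → Coprime m n → ∃ λ e → + n ∣ + m * e - 1ℤ
  coprime⇒inverse {m} {n} m⊥n with coprime-Bézout m⊥n
  ... | Bézout.+- x y 1+yn≡xm = + x , divides (+ y) (begin
    + m * + x - 1ℤ        ≡⟨ cong (_- 1ℤ) (*-comm (+ m) (+ x)) ⟩
    + x * + m - 1ℤ        ≡⟨ cong (_- 1ℤ) (pos-1+ab≡cd {y} {n} {x} {m} 1+yn≡xm) ⟨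
    1ℤ + + y * + n - 1ℤ   ≡⟨ cancel (+ y * + n) ⟩
    + y * + n             ∎)
    where
    cancel : ∀ a → 1ℤ + a - 1ℤ ≡ a
    cancel = solve-∀
  ... | Bézout.-+ x y 1+xm≡yn = - + x , divides (- + y) (begin
    + m * - + x - 1ℤ      ≡⟨ regroup (+ m) (+ x) ⟩
    - (1ℤ + + x * + m)    ≡⟨ cong -_ (pos-1+ab≡cd {x} {m} {y} {n} 1+xm≡yn) ⟩
    - (+ y * + n)         ≡⟨ neg-distribˡ-* (+ y) (+ n) ⟩
    - + y * + n           ∎)
    where
    regroup : ∀ m x → m * - x - 1ℤ ≡ - (1ℤ + x * m)
    regroup = solve-∀

  lift-to-1-mod : ∀ {m r} → Coprime m ∣ r ∣ → ∀ x → ∃ λ y → (+ m ∣ y - x) × (r ∣ y - 1ℤ)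
  lift-to-1-mod {m} {r} m⊥r x with coprime⇒inverse m⊥r
  ... | e , ∣r∣∣me-1 = x + + m * e * (1ℤ - x) , m∣y-x , r∣y-1
    where
    shift : ∀ x t → x + t - x ≡ t
    shift = solve-∀
    factor : ∀ x a → x + a * (1ℤ - x) - 1ℤ ≡ (a - 1ℤ) * (1ℤ - x)
    factor = solve-∀
    m∣y-x : + m ∣ x + + m * e * (1ℤ - x) - x
    m∣y-x = subst (+ m ∣_) (sym (shift x _)) (∣m⇒∣m*n (1ℤ - x) (∣m⇒∣m*n e ∣-refl))
    r∣y-1 : r ∣ x + + m * e * (1ℤ - x) - 1ℤ
    r∣y-1 = subst (r ∣_) (sym (factor x (+ m * e))) (∣m⇒∣m*n (1ℤ - x) (∣-trans m∣∣m∣ ∣r∣∣me-1))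

  coprime⇒unimodular-lift : ∀ {M m} (c : Fin M → ℤ) {i j} → j ≢ i → Coprime m ∣ c i ∣ →
    ∃ λ k → (∀ t → + m ∣ k t - c t) × gcdTuple k ≡ 1
  coprime⇒unimodular-lift c {i} {j} j≢i m⊥cᵢ =
    let y , m∣y-cⱼ , cᵢ∣y-1 = lift-to-1-mod {r = c i} m⊥cᵢ (c j) in
    updateAt c j (λ _ → y) , updateAt-cong-mod c j m∣y-cⱼ , gcdTuple-updateAt≡1 c j≢i y cᵢ∣y-1

  -- unitsMod filters with a function local to its where block; unification against
  -- the with-generalised unitsMod q names that function here.
  mutual
    filterUnits : ℕ → (ℕ → Bool) → List ℕ → List ℕ
    filterUnits = _

    unitsMod-filterUnits : ∀ q → unitsMod q ≡ filterUnits q (isUnitMod q) (upTo q)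
    unitsMod-filterUnits q with isUnitMod q | upTo q
    ... | f | xs = refl

  ∈-filterUnits : ∀ q f {xs v} → v ∈ xs → f v ≡ true → v ∈ filterUnits q f xs
  ∈-filterUnits q f {x ∷ xs} (here refl) fv≡true with f x
  ... | true = here refl
  ∈-filterUnits q f {x ∷ xs} (there v∈xs) fv≡true with f x
  ... | true  = there (∈-filterUnits q f v∈xs fv≡true)
  ... | false = ∈-filterUnits q f v∈xs fv≡true

  ∈-unitsMod : ∀ {q v} → v < q → isUnitMod q v ≡ true → v ∈ unitsMod q
  ∈-unitsMod {q} v<q unit =
    subst (_ ∈_) (sym (unitsMod-filterUnits q)) (∈-filterUnits q (isUnitMod q) (∈-upTo⁺ v<q) unit)

  isUnitMod⇔coprime : ∀ {q n} → isUnitMod q n ≡ true ⇔ Coprime n q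
  isUnitMod⇔coprime {q} {n} = mk⇔
    (gcd≡1⇒coprime ∘ ≡ᵇ⇒≡ (gcd n q) 1 ∘ Equivalence.from T-≡)
    (Equivalence.to T-≡ ∘ ≡⇒≡ᵇ (gcd n q) 1 ∘ coprime⇒gcd≡1)

  NonUnitValues : Poly → ℕ → Set
  NonUnitValues H q = ∀ v → isUnitMod q ∣ eval H (+ v) ∣ ≡ false

  countGood≡0 : ∀ {H q} xs → NonUnitValues H q → countGood H q xs ≡ 0
  countGood≡0 []       nonunit = refl
  countGood≡0 (x ∷ xs) nonunit rewrite nonunit x = countGood≡0 xs nonunit

  countGood≡0⇒nonunit : ∀ {H q v} xs → countGood H q xs ≡ 0 → v ∈ xs →
    isUnitMod q ∣ eval H (+ v) ∣ ≡ false
  countGood≡0⇒nonunit {H} {q} (x ∷ xs) count≡0 (here refl) with isUnitMod q ∣ eval H (+ x) ∣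
  ... | false = refl
  countGood≡0⇒nonunit {H} {q} (x ∷ xs) count≡0 (there v∈xs) with isUnitMod q ∣ eval H (+ x) ∣
  ... | false = countGood≡0⇒nonunit xs count≡0 v∈xs

  ratio-0 : ∀ d → ratio 0 d ≡ 0ℚ
  ratio-0 zero    = refl
  ratio-0 (suc d) = 0/n≡0 (suc d)

  ratio≡0⇒≡0 : ∀ n d → ratio n (suc d) ≡ 0ℚ → n ≡ 0
  ratio≡0⇒≡0 zero    d _     = refl
  ratio≡0⇒≡0 (suc n) d n/d≡0 =
    contradiction (positive⁻¹ _ {{normalize-pos (suc n) (suc d)}}) (<-irrefl (sym n/d≡0))

  nonUnitValues⇒α≡0 : ∀ {H q} → NonUnitValues H q → α H q ≡ 0ℚ
  nonUnitValues⇒α≡0 {H} {q} nonunit =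
    trans (cong (λ n → ratio n (φ q)) (countGood≡0 (unitsMod q) nonunit)) (ratio-0 (φ q))

  α≡0⇒nonunit : ∀ {H q v} → α H q ≡ 0ℚ → v ∈ unitsMod q → isUnitMod q ∣ eval H (+ v) ∣ ≡ false
  α≡0⇒nonunit {H} {q} {v} = nonunit-over (unitsMod q)
    where
    nonunit-over : ∀ xs → ratio (countGood H q xs) (length xs) ≡ 0ℚ → v ∈ xs →
      isUnitMod q ∣ eval H (+ v) ∣ ≡ false
    nonunit-over (x ∷ xs) ratio≡0 =
      countGood≡0⇒nonunit {H} {q} (x ∷ xs) (ratio≡0⇒≡0 _ (length xs) ratio≡0)

  module _ {ℓ : ℕ} (ℓ-prime : Prime ℓ) where

    ℓ∤1 : ¬ ℓ ∣ℕ 1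
    ℓ∤1 ℓ∣1 = ¬prime[1] (subst Prime (∣1⇒≡1 ℓ∣1) ℓ-prime)

    ∤⇒coprime : ∀ {n} → ¬ ℓ ∣ℕ n → Coprime ℓ n
    ∤⇒coprime ℓ∤n (d∣ℓ , d∣n) with prime⇒irreducible ℓ-prime d∣ℓ
    ... | inj₁ d≡1  = d≡1
    ... | inj₂ refl = contradiction d∣n ℓ∤n

    nonunit⇔∣ : ∀ {n} → isUnitMod ℓ n ≡ false ⇔ ℓ ∣ℕ n
    nonunit⇔∣ {n} = mk⇔ nonunit⇒∣ ∣⇒nonunit
      where
      nonunit⇒∣ : isUnitMod ℓ n ≡ false → ℓ ∣ℕ n
      nonunit⇒∣ nonunit with ℓ ∣? n
      ... | yes ℓ∣n = ℓ∣n
      ... | no ℓ∤n  = contradiction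
        (trans (sym nonunit) (Equivalence.from isUnitMod⇔coprime (coprime-sym (∤⇒coprime ℓ∤n)))) λ ()
      ∣⇒nonunit : ℓ ∣ℕ n → isUnitMod ℓ n ≡ false
      ∣⇒nonunit ℓ∣n = ¬-not λ unit →
        ℓ∤1 (subst (ℓ ∣ℕ_) (Equivalence.to isUnitMod⇔coprime unit (ℓ∣n , ∣ℕ-refl)) ∣ℕ-refl)

    ∈-unitsMod-prime : ∀ {b} → 0 < b → b < ℓ → b ∈ unitsMod ℓ
    ∈-unitsMod-prime 0<b b<ℓ = ∈-unitsMod b<ℓ
      (Equivalence.from isUnitMod⇔coprime (coprime-sym (prime⇒coprime ℓ-prime {{>-nonZero 0<b}} b<ℓ)))

    ∣*-cancelˡ-small : ∀ {d x} → 0 < ∣ d ∣ → ∣ d ∣ < ℓ → + ℓ ∣ d * x → + ℓ ∣ x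
    ∣*-cancelˡ-small {d} {x} 0<d d<ℓ ℓ∣dx =
      ∣ᵤ⇒∣ (coprime-divisor (+ ℓ) d x (prime⇒coprime ℓ-prime {{>-nonZero 0<d}} d<ℓ) (∣⇒∣ᵤ ℓ∣dx))

    -- Divide out the root n; the remaining roots b < n survive in the quotient since ℓ ∤ b − n.
    ∣ₚ-from-roots : ∀ n P → n < ℓ → + ℓ ∣ₚ P from n →
      (∀ b → 0 < b → b ≤ n → + ℓ ∣ eval P (+ b)) → + ℓ ∣ₚ P
    ∣ₚ-from-roots zero    P _   high _     j = high j z≤n
    ∣ₚ-from-roots (suc n) P n<ℓ high roots =
      ∣ₚ/[X-]⇒∣ₚ P a (roots (suc n) (s≤s z≤n) ≤-refl)
        (∣ₚ-from-roots n (P /[X- a ]) (<-trans (n<1+n n) n<ℓ) (/[X-]-∣ₚ-from n P a high) quotient-roots)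
      where
      a : ℤ
      a = + suc n
      quotient-roots : ∀ b → 0 < b → b ≤ n → + ℓ ∣ eval (P /[X- a ]) (+ b)
      quotient-roots b 0<b b≤n = ∣*-cancelˡ-small {d = + b - a} 0<∣b-a∣ ∣b-a∣<ℓ
        (∣m+n∣m⇒∣n (subst (+ ℓ ∣_) (remainder-theorem P (+ b) a) (roots b 0<b (m≤n⇒m≤1+n b≤n)))
                   (roots (suc n) (s≤s z≤n) ≤-refl))
        where
        ∣b-a∣≡a∸b : ∣ + b - a ∣ ≡ suc n ∸ b
        ∣b-a∣≡a∸b = trans (cong ∣_∣ (m-n≡m⊖n b (suc n))) (∣⊖∣-< (s≤s b≤n))
        0<∣b-a∣ : 0 < ∣ + b - a ∣
        0<∣b-a∣ = subst (0 <_) (sym ∣b-a∣≡a∸b) (m<n⇒0<n∸m (s≤s b≤n))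
        ∣b-a∣<ℓ : ∣ + b - a ∣ < ℓ
        ∣b-a∣<ℓ = subst (_< ℓ) (sym ∣b-a∣≡a∸b) (≤-<-trans (m∸n≤m (suc n) b) n<ℓ)

    ∣ₚ⇒α≡0 : ∀ {H} → + ℓ ∣ₚ H → α H ℓ ≡ 0ℚ
    ∣ₚ⇒α≡0 {H} ℓ∣H =
      nonUnitValues⇒α≡0 {H} λ v → Equivalence.from nonunit⇔∣ (∣⇒∣ᵤ (∣ₚ⇒∣eval H ℓ∣H (+ v)))

    α≡0⇒∣ₚ : ∀ {H} d → suc d < ℓ → (∀ j → d < j → coeff H j ≡ 0ℤ) → α H ℓ ≡ 0ℚ → + ℓ ∣ₚ H
    α≡0⇒∣ₚ {H} d d+1<ℓ deg≤d α≡0 = ∣ₚ-from-roots (suc d) H d+1<ℓ high roots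
      where
      high : + ℓ ∣ₚ H from suc d
      high j d<j = subst (+ ℓ ∣_) (sym (deg≤d j d<j)) ∣0ℤ
      roots : ∀ b → 0 < b → b ≤ suc d → + ℓ ∣ eval H (+ b)
      roots b 0<b b≤d+1 = ∣ᵤ⇒∣ (Equivalence.to nonunit⇔∣
        (α≡0⇒nonunit {H} α≡0 (∈-unitsMod-prime 0<b (≤-<-trans b≤d+1 d+1<ℓ))))

    alphaCondition⇒linIndep : ∀ {M} {G : Fin M → Poly} → 2 ≤ M → AlphaCondition G ℓ → LinIndepModℓ G ℓ
    alphaCondition⇒linIndep {suc (suc _)} {G} (s≤s (s≤s z≤n)) alphaCond c c-relation i
      with ℓ ∣? ∣ c i ∣
    ... | yes ℓ∣cᵢ = ℓ∣cᵢ
    ... | no ℓ∤cᵢ =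
      let k , k≡c , gcd≡1 = coprime⇒unimodular-lift c (punchInᵢ≢i i zero) (∤⇒coprime ℓ∤cᵢ) in
      contradiction (∣ₚ⇒α≡0 (∣ₚ-linComb-cong k c G k≡c (∣ᵤ⇒∣ ∘ c-relation))) (alphaCond k gcd≡1)

    linIndep⇒alphaCondition : ∀ {M} {G : Fin M → Poly} → maxDeg G ℕ.+ 1 < ℓ →
      LinIndepModℓ G ℓ → AlphaCondition G ℓ
    linIndep⇒alphaCondition {G = G} D+1<ℓ indep k gcd≡1 α≡0 =
      ℓ∤1 (subst (ℓ ∣ℕ_) gcd≡1 (∣gcdTuple k (indep k (∣⇒∣ᵤ ∘ linComb-vanishes))))
      where
      linComb-vanishes : + ℓ ∣ₚ linComb k G
      linComb-vanishes = α≡0⇒∣ₚ (maxDeg G) (subst (_< ℓ) (+-comm (maxDeg G) 1) D+1<ℓ)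
        (λ j → coeff-linComb-maxDeg< k G) α≡0

open import Data.Nat using (ℕ; _≤_; _<_; _+_)
open import Data.Nat.Primality using (Prime)
open import Data.Integer using (ℤ; +_)
open import Data.Fin using (Fin)
open import Data.Product using (_×_; _,_)
open import Relation.Binary.PropositionalEquality using (_≡_)

lemma2p4 : (M : ℕ) → 2 ≤ M →
    (G : Fin M → Poly) → (∀ i → 1 ≤ deg (G i)) →
    (g : Fin M → ℕ → ℤ) → (∀ i → Additive (g i)) →
    (∀ i p → Prime p → g i p ≡ eval (G i) (+ p)) →
    (ℓ : ℕ) → Prime ℓ →
    (AlphaCondition G ℓ → LinIndepModℓ G ℓ) ×
    (maxDeg G + 1 < ℓ → LinIndepModℓ G ℓ → AlphaCondition G ℓ)
lemma2p4 _ 2≤M _ _ _ _ _ _ ℓ-prime =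
  alphaCondition⇒linIndep ℓ-prime 2≤M , linIndep⇒alphaCondition ℓ-prime
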